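{- Let $n\geq 3$ be an integer. Then $I_n^*=\operatorname{DNSG}(n)$.
   Context: The polynomials $\operatorname{R}_n\in\mathbb{Z}[X_1,X_2,\ldots]$ ($n\geq 2$) are defined recursively by $\operatorname{R}_2=0$ and $\operatorname{R}_{n+1}=A_n+\mathrm{L}(\operatorname{R}_n)+\mathrm{H}(\operatorname{R}_n)$, where $A_n=-\sum_{k=1}^{n-1}\binom{n}{k}X_{1+k}X_{1+n-k}X_n$, and $\mathrm{L},\mathrm{H}$ are the linear operators on polynomials defined on monomials by $\mathrm{L}(X_{\alpha_1}\cdots X_{\alpha_r})=\sum_{1\leq i<j\leq r}X_{\alpha_1}\cdots X_{\alpha_i+1}\cdots X_{\alpha_j+1}\cdots X_{\alpha_r}$ (the factors $X_{\alpha_i},X_{\alpha_j}$ replaced by $X_{\alpha_i+1},X_{\alpha_j+1}$) and $\mathrm{H}(X_{\alpha_1}\cdots X_{\alpha_r})=-\frac12\sum_{k=1}^r\sum_{l=1}^{\alpha_k-1}\binom{\alpha_k}{l}X_{1+l}X_{1+\alpha_k-l}\prod_{i\neq k}X_{\alpha_i}$, for positive integers $\alpha_1,\ldots,\alpha_r$. For a finite sequence $\boldsymbol{\alpha}=(\alpha_1,\ldots,\alpha_r)$ write $X_{\boldsymbol{\alpha}}=X_{\alpha_1}\cdots X_{\alpha_r}$. $I_n$ is the set of integer sequences $\boldsymbol{\alpha}=(\alpha_1,\ldots,\alpha_r)$ with $r\geq 3$, $\alpha_1\geq\cdots\geq\alpha_r$, $2\leq\alpha_k\leq n-1$ for all $k$,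 and $\sum_k\alpha_k=2n$; one has $\operatorname{R}_n=\sum_{\boldsymbol{\alpha}\in I_n}c^{(n)}_{\boldsymbol{\alpha}}X_{\boldsymbol{\alpha}}$, and $I_n^*$ is the set of $\boldsymbol{\alpha}\in I_n$ with $c^{(n)}_{\boldsymbol{\alpha}}\neq 0$. $\operatorname{DNSG}(n)$ is the set of finite integer sequences $(d_1,\ldots,d_r)$ with $r\geq 3$ such that $d_1\geq\cdots\geq d_r\geq 2$, $\sum_{k=1}^r d_k=2n$, and $d_1\leq d_2+\cdots+d_r-2r+4$. -}

module Defs where

open import Data.Nat using (ℕ; zero; suc; _+_; _*_; _∸_; _≤_; _≥_; _≤ᵇ_)
open import Data.Nat.Combinatorics using (_C_)
open import Data.Bool using (if_then_else_)
open import Data.Integer using (+_)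
open import Data.Rational using (ℚ; 0ℚ; _/_; -½; -_) renaming (_+_ to _+ℚ_; _*_ to _*ℚ_)
open import Data.List using (List; []; _∷_; [_]; map; _++_; length; concatMap; upTo; filter)
open import Data.Nat.ListAction using (sum)
open import Data.List.Properties using (≡-dec)
open import Data.List.Relation.Unary.All using (All)
open import Data.List.Relation.Unary.Linked using (Linked)
open import Data.Nat.Properties using (_≟_)
open import Data.Product using (_×_; _,_; proj₁; proj₂)
open import Relation.Binary.PropositionalEquality using (_≡_; _≢_)
open import Relation.Nullary.Decidable using (⌊_⌋)

-- A monomial X_{α1}⋯X_{αr} is represented by the list of indices (α1,…,αr).
Mono : Set
Mono = List ℕ

-- A polynomial is a formal (unnormalised) sum of terms c·X_α, c ∈ ℚ.
Poly : Set
Poly = List (ℚ × Mono)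

fromℕℚ : ℕ → ℚ
fromℕℚ n = (+ n) / 1

-- Descending insertion sort: the normal form of a monomial (variables commute).
insertDesc : ℕ → List ℕ → List ℕ
insertDesc x [] = x ∷ []
insertDesc x (y ∷ ys) = if y ≤ᵇ x then x ∷ y ∷ ys else y ∷ insertDesc x ys

sortDesc : List ℕ → List ℕ
sortDesc [] = []
sortDesc (x ∷ xs) = insertDesc x (sortDesc xs)

range : ℕ → ℕ → List ℕ
range a b = map (λ i → a + i) (upTo (suc b ∸ a))

A : ℕ → Poly
A n = map (λ k → (- fromℕℚ (n C k) , (suc k ∷ suc (n ∸ k) ∷ n ∷ []))) (range 1 (n ∸ 1))

incOne : Mono → List Mono
incOne [] = []
incOne (a ∷ as) = (suc a ∷ as) ∷ map (a ∷_) (incOne as)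

incTwo : Mono → List Mono
incTwo [] = []
incTwo (a ∷ as) = map (suc a ∷_) (incOne as) ++ map (a ∷_) (incTwo as)

L : Poly → Poly
L = concatMap (λ t → map (λ m → (proj₁ t , m)) (incTwo (proj₂ t)))

splitAt1 : Mono → List (ℚ × Mono)
splitAt1 [] = []
splitAt1 (a ∷ as) =
  map (λ l → (-½ *ℚ fromℕℚ (a C l) , (suc l ∷ suc (a ∸ l) ∷ as))) (range 1 (a ∸ 1))
  ++ map (λ t → (proj₁ t , a ∷ proj₂ t)) (splitAt1 as)

H : Poly → Poly
H = concatMap (λ t → map (λ s → (proj₁ t *ℚ proj₁ s , proj₂ s)) (splitAt1 (proj₂ t)))

-- R_n for n ≥ 2 (R 0, R 1 are unused junk values); R_2 = 0,
-- R_{n+1} = A_n + L(R_n) + H(R_n).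
R : ℕ → Poly
R 0 = []
R 1 = []
R 2 = []
R (suc (suc (suc m))) = A (suc (suc m)) ++ L (R (suc (suc m))) ++ H (R (suc (suc m)))

-- coefficient of X_α in a polynomial (α given in nonincreasing order)
coeff : Poly → Mono → ℚ
coeff P α = sum' (filter (λ t → ≡-dec _≟_ (sortDesc (proj₂ t)) α) P)
  where
  sum' : Poly → ℚ
  sum' [] = 0ℚ
  sum' (t ∷ ts) = proj₁ t +ℚ sum' ts

c : ℕ → Mono → ℚ
c n α = coeff (R n) α

Nonincreasing : List ℕ → Set
Nonincreasing = Linked _≥_

I : ℕ → List ℕ → Set
I n α = (3 ≤ length α) × Nonincreasing α × All (λ a → 2 ≤ a × a ≤ n ∸ 1) α × (sum α ≡ 2 * n)

I* : ℕ → List ℕ → Set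
I* n α = I n α × (c n α ≢ 0ℚ)

-- d_1 ≤ d_2 + ⋯ + d_r − 2r + 4, rearranged over ℕ as d_1 + 2r ≤ d_2 + ⋯ + d_r + 4
DomCond : List ℕ → Set
DomCond [] = Data.Unit.⊤ where import Data.Unit
DomCond (d₁ ∷ ds) = d₁ + 2 * suc (length ds) ≤ sum ds + 4

DNSG : ℕ → List ℕ → Set
DNSG n d = (3 ≤ length d) × Nonincreasing d × All (2 ≤_) d × (sum d ≡ 2 * n) × DomCond d

-- Every monomial produced by the recursion is admissible: its factors are ≥ 2, there are
-- at least three of them, and every factor x satisfies x + r ≤ n + 2, where r is the number
-- of factors; given that the degrees sum to 2n this is exactly the domination condition of
-- DNSG(n). A_n consists of admissible monomials, and L (raise two factors) and H (split a
-- factor a into l + 1 and a − l + 1) carry admissible monomials of level n to level n + 1.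
-- Conversely every admissible monomial is reached: read in increasing order, either it is
-- (x, n + 2 − x, n), a term of A_n, or lowering its two largest factors (three factors) or
-- merging its two smallest ones (at least four) gives an admissible monomial of level n − 1.
-- Finally there is no cancellation: a term with r factors has sign (−1)^r, since A_n is
-- negative, L keeps coefficients and H multiplies them by −½·binomial < 0.
module Submission where

open import Defs
open import Data.Empty using (⊥; ⊥-elim)
open import Data.List using (List; []; _∷_; map; length)
open import Data.List.Membership.Propositional using (_∈_)
open import Data.List.Membership.Propositional.Properties
  using (∈-map⁺; ∈-map⁻; ∈-++⁺ˡ; ∈-++⁺ʳ; ∈-++⁻; ∈-upTo⁺; ∈-upTo⁻)
open import Data.List.Properties using (≡-dec)
open import Data.List.Relation.Binary.Permutation.Propositional
  using (_↭_; refl; prep; swap; trans; ↭-sym; ↭-trans; ↭⇒↭ₛ)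
open import Data.List.Relation.Binary.Permutation.Propositional.Properties using (↭-length; All-resp-↭)
open import Data.List.Relation.Binary.Pointwise using (Pointwise-≡⇒≡)
open import Data.List.Relation.Unary.All as All using (All; []; _∷_)
import Data.List.Relation.Unary.All.Properties as AllP
open import Data.List.Relation.Unary.Any as Any using (Any; here; there)
import Data.List.Relation.Unary.Any.Properties as AnyP
open import Data.List.Relation.Unary.Linked using ([]; [-]; _∷_)
open import Data.List.Relation.Unary.Linked.Properties using (Linked⇒All)
open import Data.List.Relation.Unary.Sorted.TotalOrder using (Sorted)
open import Data.List.Relation.Unary.Sorted.TotalOrder.Properties using (↗↭↗⇒≋)
import Data.List.Sort.InsertionSort.Base as InsertionSort
import Data.List.Sort.InsertionSort.Properties as InsertionSortProperties
open import Data.Nat using (ℕ; zero; suc; _+_; _*_; _∸_; _≤_; _<_; z≤n; s≤s; s≤s⁻¹)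
open import Data.Nat.Combinatorics using (_C_; nCk+nC[k+1]≡[n+1]C[k+1])
open import Data.Nat.ListAction using (sum)
open import Data.Nat.ListAction.Properties using (sum-↭)
open import Data.Nat.Properties
open import Data.Nat.Tactic.RingSolver using (solve-∀)
open import Data.Product using (∃-syntax; _×_; _,_; proj₁; proj₂)
open import Data.Rational using (ℚ; 0ℚ; -½; Positive; Negative; NonNegative; NonPositive)
  renaming (_+_ to _+ℚ_; _*_ to _*ℚ_)
import Data.Rational.Properties as ℚ
open import Data.Sum using (inj₁; inj₂)
open import Function using (_∘_; id; flip)
open import Function.Bundles using (_⇔_; mk⇔; Equivalence)
import Relation.Binary.Construct.Flip.EqAndOrd as Flip
open import Relation.Binary.PropositionalEquality as ≡ using (_≡_; _≢_; refl; sym; cong; subst)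
open import Relation.Nullary using (yes; no)

module Descending = InsertionSort (Flip.decTotalOrder ≤-decTotalOrder)
module Ascending = InsertionSort ≤-decTotalOrder

insertDesc≡insert : ∀ x xs → insertDesc x xs ≡ Descending.insert x xs
insertDesc≡insert x [] = refl
insertDesc≡insert x (y ∷ ys) rewrite insertDesc≡insert x ys = refl

sortDesc≡sort : ∀ xs → sortDesc xs ≡ Descending.sort xs
sortDesc≡sort [] = refl
sortDesc≡sort (x ∷ xs) rewrite sortDesc≡sort xs = insertDesc≡insert x (Descending.sort xs)

sortDesc-↭ : ∀ xs → sortDesc xs ↭ xs
sortDesc-↭ xs rewrite sortDesc≡sort xs =
  InsertionSortProperties.sort-↭ (Flip.decTotalOrder ≤-decTotalOrder) xs

sortDesc-nonincreasing : ∀ xs → Nonincreasing (sortDesc xs)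
sortDesc-nonincreasing xs rewrite sortDesc≡sort xs =
  InsertionSortProperties.sort-↗ (Flip.decTotalOrder ≤-decTotalOrder) xs

nonincreasing-↭⇒≡ : ∀ {xs ys} → Nonincreasing xs → Nonincreasing ys → xs ↭ ys → xs ≡ ys
nonincreasing-↭⇒≡ xs↘ ys↘ xs↭ys =
  Pointwise-≡⇒≡ (↗↭↗⇒≋ (Flip.totalOrder ≤-totalOrder) xs↘ ys↘ (↭⇒↭ₛ xs↭ys))

sort-↭ : ∀ xs → Ascending.sort xs ↭ xs
sort-↭ = InsertionSortProperties.sort-↭ ≤-decTotalOrder

sort-increasing : ∀ xs → Sorted ≤-totalOrder (Ascending.sort xs)
sort-increasing = InsertionSortProperties.sort-↗ ≤-decTotalOrder

Signed : ℕ → ℚ → Set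
Signed 0 q = Positive q
Signed 1 q = Negative q
Signed (suc (suc r)) q = Signed r q

WeaklySigned : ℕ → ℚ → Set
WeaklySigned 0 q = NonNegative q
WeaklySigned 1 q = NonPositive q
WeaklySigned (suc (suc r)) q = WeaklySigned r q

Signed-*-neg : ∀ r {p q} → Signed r p → Negative q → Signed (suc r) (p *ℚ q)
Signed-*-neg 0 {p} {q} p>0 q<0 = ℚ.pos*neg⇒neg p {{p>0}} q {{q<0}}
Signed-*-neg 1 {p} {q} p<0 q<0 = ℚ.neg*neg⇒pos p {{p<0}} q {{q<0}}
Signed-*-neg (suc (suc r)) = Signed-*-neg r

Signed-+ : ∀ r {p q} → Signed r p → WeaklySigned r q → Signed r (p +ℚ q)
Signed-+ 0 {p} {q} p>0 q≥0 = ℚ.pos+nonNeg⇒pos p {{p>0}} q {{q≥0}}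
Signed-+ 1 {p} {q} p<0 q≤0 = ℚ.neg+nonPos⇒neg p {{p<0}} q {{q≤0}}
Signed-+ (suc (suc r)) = Signed-+ r

WeaklySigned-+ : ∀ r {p q} → WeaklySigned r p → WeaklySigned r q → WeaklySigned r (p +ℚ q)
WeaklySigned-+ 0 {p} {q} p≥0 q≥0 = ℚ.nonNeg+nonNeg⇒nonNeg p {{p≥0}} q {{q≥0}}
WeaklySigned-+ 1 {p} {q} p≤0 q≤0 = ℚ.nonPos+nonPos⇒nonPos p {{p≤0}} q {{q≤0}}
WeaklySigned-+ (suc (suc r)) = WeaklySigned-+ r

WeaklySigned-0 : ∀ r → WeaklySigned r 0ℚ
WeaklySigned-0 0 = _
WeaklySigned-0 1 = _
WeaklySigned-0 (suc (suc r)) = WeaklySigned-0 r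

Signed⇒WeaklySigned : ∀ r {q} → Signed r q → WeaklySigned r q
Signed⇒WeaklySigned 0 {q} q>0 = ℚ.pos⇒nonNeg q {{q>0}}
Signed⇒WeaklySigned 1 {q} q<0 = ℚ.neg⇒nonPos q {{q<0}}
Signed⇒WeaklySigned (suc (suc r)) = Signed⇒WeaklySigned r

Signed⇒≢0 : ∀ r {q} → Signed r q → q ≢ 0ℚ
Signed⇒≢0 0 {q} q>0 q≡0 = ℚ.<-irrefl (sym q≡0) (ℚ.positive⁻¹ q {{q>0}})
Signed⇒≢0 1 {q} q<0 q≡0 = ℚ.<-irrefl q≡0 (ℚ.negative⁻¹ q {{q<0}})
Signed⇒≢0 (suc (suc r)) = Signed⇒≢0 r

nCk>0 : ∀ {n k} → k ≤ n → 0 < n C k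
nCk>0 {n} {zero} _ = s≤s z≤n
nCk>0 {suc n} {suc k} (s≤s k≤n) =
  subst (0 <_) (nCk+nC[k+1]≡[n+1]C[k+1] n k) (<-≤-trans (nCk>0 k≤n) (m≤m+n _ _))

fromℕℚ-positive : ∀ {k} → 0 < k → Positive (fromℕℚ k)
fromℕℚ-positive {suc k} _ = ℚ.normalize-pos (suc k) 1

-½*nCk-negative : ∀ {a l} → l ≤ a → Negative (-½ *ℚ fromℕℚ (a C l))
-½*nCk-negative {a} {l} l≤a = ℚ.neg*pos⇒neg -½ (fromℕℚ (a C l)) {{fromℕℚ-positive (nCk>0 l≤a)}}

∈-range⁺ : ∀ {l b} → 1 ≤ l → l ≤ b → l ∈ range 1 b
∈-range⁺ {suc l} (s≤s z≤n) l≤b = ∈-map⁺ suc (∈-upTo⁺ l≤b)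

∈-range⁻ : ∀ {l b} → l ∈ range 1 b → 1 ≤ l × l ≤ b
∈-range⁻ l∈ with ∈-map⁻ suc l∈
... | i , i∈ , refl = s≤s z≤n , ∈-upTo⁻ i∈

1≤l≤a∸1⇒l<a : ∀ {l a} → 1 ≤ l → l ≤ a ∸ 1 → l < a
1≤l≤a∸1⇒l<a {a = zero} (s≤s _) ()
1≤l≤a∸1⇒l<a {a = suc a} _ l≤a = s≤s l≤a

1≤l≤a⇒a∸l<a : ∀ {a l} → 1 ≤ l → l ≤ a → a ∸ l < a
1≤l≤a⇒a∸l<a {suc a} {suc l} _ _ = s≤s (m∸n≤m a l)

data IncOne : Mono → Mono → Set where
  inc₁-here  : ∀ {a as} → IncOne (a ∷ as) (suc a ∷ as)
  inc₁-there : ∀ {a as bs} → IncOne as bs → IncOne (a ∷ as) (a ∷ bs)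

data IncTwo : Mono → Mono → Set where
  inc₂-here  : ∀ {a as bs} → IncOne as bs → IncTwo (a ∷ as) (suc a ∷ bs)
  inc₂-there : ∀ {a as bs} → IncTwo as bs → IncTwo (a ∷ as) (a ∷ bs)

data Split : Mono → Mono → Set where
  split-here  : ∀ {a as l} → 1 ≤ l → l ≤ a ∸ 1 → Split (a ∷ as) (suc l ∷ suc (a ∸ l) ∷ as)
  split-there : ∀ {a as bs} → Split as bs → Split (a ∷ as) (a ∷ bs)

IncOne⇒∈incOne : ∀ {m m'} → IncOne m m' → m' ∈ incOne m
IncOne⇒∈incOne inc₁-here = here refl
IncOne⇒∈incOne (inc₁-there i) = there (∈-map⁺ (_ ∷_) (IncOne⇒∈incOne i))

∈incOne⇒IncOne : ∀ m {m'} → m' ∈ incOne m → IncOne m m'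
∈incOne⇒IncOne (a ∷ as) (here refl) = inc₁-here
∈incOne⇒IncOne (a ∷ as) (there m'∈) with ∈-map⁻ (a ∷_) m'∈
... | _ , bs∈ , refl = inc₁-there (∈incOne⇒IncOne as bs∈)

IncTwo⇒∈incTwo : ∀ {m m'} → IncTwo m m' → m' ∈ incTwo m
IncTwo⇒∈incTwo {a ∷ as} (inc₂-here i) = ∈-++⁺ˡ (∈-map⁺ (suc a ∷_) (IncOne⇒∈incOne i))
IncTwo⇒∈incTwo {a ∷ as} (inc₂-there i) =
  ∈-++⁺ʳ (map (suc a ∷_) (incOne as)) (∈-map⁺ (a ∷_) (IncTwo⇒∈incTwo i))

∈incTwo⇒IncTwo : ∀ m {m'} → m' ∈ incTwo m → IncTwo m m'
∈incTwo⇒IncTwo (a ∷ as) m'∈ with ∈-++⁻ (map (suc a ∷_) (incOne as)) m'∈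
... | inj₁ m'∈₁ with ∈-map⁻ (suc a ∷_) m'∈₁
...   | _ , bs∈ , refl = inc₂-here (∈incOne⇒IncOne as bs∈)
∈incTwo⇒IncTwo (a ∷ as) m'∈ | inj₂ m'∈₂ with ∈-map⁻ (a ∷_) m'∈₂
...   | _ , bs∈ , refl = inc₂-there (∈incTwo⇒IncTwo as bs∈)

Split⇒∈splitAt1 : ∀ {m m'} → Split m m' → Any ((m' ≡_) ∘ proj₂) (splitAt1 m)
Split⇒∈splitAt1 {a ∷ as} (split-here 1≤l l≤a∸1) =
  AnyP.++⁺ˡ (AnyP.map⁺ (Any.map (cong (λ l → suc l ∷ suc (a ∸ l) ∷ as)) (∈-range⁺ 1≤l l≤a∸1)))
Split⇒∈splitAt1 {a ∷ as} (split-there s) =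
  AnyP.++⁺ʳ _ (AnyP.map⁺ (Any.map (cong (a ∷_)) (Split⇒∈splitAt1 s)))

splitAt1-negative-Split : ∀ m → All (λ s → Negative (proj₁ s) × Split m (proj₂ s)) (splitAt1 m)
splitAt1-negative-Split [] = []
splitAt1-negative-Split (a ∷ as) = AllP.++⁺
  (AllP.map⁺ (All.tabulate λ l∈ →
    let 1≤l , l≤a∸1 = ∈-range⁻ l∈ in
    -½*nCk-negative (≤-trans l≤a∸1 (m∸n≤m a 1)) , split-here 1≤l l≤a∸1))
  (AllP.map⁺ (All.map (λ (q<0 , s) → q<0 , split-there s) (splitAt1-negative-Split as)))

lift-IncOne : ∀ {m d d'} → m ↭ d → IncOne d d' → ∃[ m' ] IncOne m m' × m' ↭ d'
lift-IncOne refl i = _ , i , refl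
lift-IncOne (prep x p) inc₁-here = _ , inc₁-here , prep _ p
lift-IncOne (prep x p) (inc₁-there i) with lift-IncOne p i
... | _ , j , q = _ , inc₁-there j , prep x q
lift-IncOne (swap x y p) inc₁-here = _ , inc₁-there inc₁-here , swap _ _ p
lift-IncOne (swap x y p) (inc₁-there inc₁-here) = _ , inc₁-here , swap _ _ p
lift-IncOne (swap x y p) (inc₁-there (inc₁-there i)) with lift-IncOne p i
... | _ , j , q = _ , inc₁-there (inc₁-there j) , swap x y q
lift-IncOne (trans p q) i with lift-IncOne q i
... | _ , j , r with lift-IncOne p j
... | _ , j' , r' = _ , j' , ↭-trans r' r

lift-IncTwo : ∀ {m d d'} → m ↭ d → IncTwo d d' → ∃[ m' ] IncTwo m m' × m' ↭ d'
lift-IncTwo refl i = _ , i , refl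
lift-IncTwo (prep x p) (inc₂-here i) with lift-IncOne p i
... | _ , j , q = _ , inc₂-here j , prep _ q
lift-IncTwo (prep x p) (inc₂-there i) with lift-IncTwo p i
... | _ , j , q = _ , inc₂-there j , prep x q
lift-IncTwo (swap x y p) (inc₂-here inc₁-here) = _ , inc₂-here inc₁-here , swap _ _ p
lift-IncTwo (swap x y p) (inc₂-here (inc₁-there i)) with lift-IncOne p i
... | _ , j , q = _ , inc₂-there (inc₂-here j) , swap _ _ q
lift-IncTwo (swap x y p) (inc₂-there (inc₂-here i)) with lift-IncOne p i
... | _ , j , q = _ , inc₂-here (inc₁-there j) , swap _ _ q
lift-IncTwo (swap x y p) (inc₂-there (inc₂-there i)) with lift-IncTwo p i
... | _ , j , q = _ , inc₂-there (inc₂-there j) , swap _ _ q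
lift-IncTwo (trans p q) i with lift-IncTwo q i
... | _ , j , r with lift-IncTwo p j
... | _ , j' , r' = _ , j' , ↭-trans r' r

lift-Split : ∀ {m d d'} → m ↭ d → Split d d' → ∃[ m' ] Split m m' × m' ↭ d'
lift-Split refl s = _ , s , refl
lift-Split (prep x p) (split-here u v) = _ , split-here u v , prep _ (prep _ p)
lift-Split (prep x p) (split-there s) with lift-Split p s
... | _ , t , q = _ , split-there t , prep x q
lift-Split (swap x y p) (split-here u v) =
  _ , split-there (split-here u v) , ↭-trans (swap _ _ (prep _ p)) (prep _ (swap _ _ refl))
lift-Split (swap x y p) (split-there (split-here u v)) =
  _ , split-here u v , ↭-trans (prep _ (swap _ _ p)) (swap _ _ (prep _ refl))
lift-Split (swap x y p) (split-there (split-there s)) with lift-Split p s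
... | _ , t , q = _ , split-there (split-there t) , swap _ _ q
lift-Split (trans p q) s with lift-Split q s
... | _ , t , r with lift-Split p t
... | _ , t' , r' = _ , t' , ↭-trans r' r

IncOne-length : ∀ {m m'} → IncOne m m' → length m' ≡ length m
IncOne-length inc₁-here = refl
IncOne-length (inc₁-there i) = cong suc (IncOne-length i)

IncTwo-length : ∀ {m m'} → IncTwo m m' → length m' ≡ length m
IncTwo-length (inc₂-here i) = cong suc (IncOne-length i)
IncTwo-length (inc₂-there i) = cong suc (IncTwo-length i)

Split-length : ∀ {m m'} → Split m m' → length m' ≡ suc (length m)
Split-length (split-here _ _) = refl
Split-length (split-there s) = cong suc (Split-length s)

IncOne-sum : ∀ {m m'} → IncOne m m' → sum m' ≡ 1 + sum m
IncOne-sum inc₁-here = refl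
IncOne-sum {a ∷ _} (inc₁-there i) = ≡.trans (cong (a +_) (IncOne-sum i)) (+-suc a _)

IncTwo-sum : ∀ {m m'} → IncTwo m m' → sum m' ≡ 2 + sum m
IncTwo-sum {a ∷ _} (inc₂-here i) = cong suc (≡.trans (cong (a +_) (IncOne-sum i)) (+-suc a _))
IncTwo-sum {a ∷ _} (inc₂-there i) =
  ≡.trans (cong (a +_) (IncTwo-sum i)) (≡.trans (+-suc a _) (cong suc (+-suc a _)))

Split-sum : ∀ {m m'} → Split m m' → sum m' ≡ 2 + sum m
Split-sum {a ∷ as} (split-here {l = l} 1≤l l≤a∸1) =
  cong suc (≡.trans (+-suc l _)
    (cong suc (≡.trans (sym (+-assoc l (a ∸ l) (sum as))) (cong (_+ sum as) (m+[n∸m]≡n l≤a)))))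
  where l≤a = <⇒≤ (1≤l≤a∸1⇒l<a 1≤l l≤a∸1)
Split-sum {a ∷ _} (split-there s) =
  ≡.trans (cong (a +_) (Split-sum s)) (≡.trans (+-suc a _) (cong suc (+-suc a _)))

module _ {P Q : ℕ → Set} (keep : ∀ {x} → P x → Q x) where

  IncOne-All : (∀ {x} → P x → Q (suc x)) → ∀ {m m'} → All P m → IncOne m m' → All Q m'
  IncOne-All inc (p ∷ ps) inc₁-here = inc p ∷ All.map keep ps
  IncOne-All inc (p ∷ ps) (inc₁-there i) = keep p ∷ IncOne-All inc ps i

  IncTwo-All : (∀ {x} → P x → Q (suc x)) → ∀ {m m'} → All P m → IncTwo m m' → All Q m'
  IncTwo-All inc (p ∷ ps) (inc₂-here i) = inc p ∷ IncOne-All inc ps i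
  IncTwo-All inc (p ∷ ps) (inc₂-there i) = keep p ∷ IncTwo-All inc ps i

  Split-All : (∀ {a l} → 1 ≤ l → l < a → P a → Q (suc l) × Q (suc (a ∸ l)))
            → ∀ {m m'} → All P m → Split m m' → All Q m'
  Split-All split (p ∷ ps) (split-here 1≤l l≤a∸1) =
    let q₁ , q₂ = split 1≤l (1≤l≤a∸1⇒l<a 1≤l l≤a∸1) p in q₁ ∷ q₂ ∷ All.map keep ps
  Split-All split (p ∷ ps) (split-there s) = keep p ∷ Split-All split ps s

record Admissible (n : ℕ) (m : Mono) : Set where
  constructor admissible
  field
    length≥3 : 3 ≤ length m
    factors≥2 : All (2 ≤_) m
    sum≡2n : sum m ≡ 2 * n
    bounded : All (λ x → x + length m ≤ n + 2) m

Admissible-resp-↭ : ∀ {n xs ys} → xs ↭ ys → Admissible n xs → Admissible n ys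
Admissible-resp-↭ {n} {xs} p (admissible l≥3 x≥2 s bd) =
  admissible (subst (3 ≤_) |p| l≥3) (All-resp-↭ p x≥2) (≡.trans (sym (sum-↭ p)) s)
    (All-resp-↭ p (subst (λ r → All (λ x → x + r ≤ n + 2) xs) |p| bd))
  where |p| = ↭-length p

2*length≤sum : ∀ xs → All (2 ≤_) xs → 2 * length xs ≤ sum xs
2*length≤sum [] [] = z≤n
2*length≤sum (x ∷ xs) (x≥2 ∷ xs≥2) =
  subst (_≤ x + sum xs) (sym (*-suc 2 (length xs))) (+-mono-≤ x≥2 (2*length≤sum xs xs≥2))

¬Admissible-2 : ∀ {m} → Admissible 2 m → ⊥
¬Admissible-2 {m} (admissible l≥3 x≥2 s _)
  with subst (6 ≤_) s (≤-trans (*-monoʳ-≤ 2 l≥3) (2*length≤sum m x≥2))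
... | s≤s (s≤s (s≤s (s≤s ())))

sum-step : ∀ {s s' n} → s' ≡ 2 + s → s ≡ 2 * n → s' ≡ 2 * suc n
sum-step {n = n} e s = ≡.trans e (≡.trans (cong (2 +_) s) (sym (*-suc 2 n)))

sum-unstep : ∀ {s s' n} → s' ≡ 2 + s → s' ≡ 2 * suc n → s ≡ 2 * n
sum-unstep {n = n} e s = suc-injective (suc-injective (≡.trans (sym e) (≡.trans s (*-suc 2 n))))

IncTwo-admissible : ∀ {n m m'} → Admissible n m → IncTwo m m' → Admissible (suc n) m'
IncTwo-admissible {n} {m' = m'} (admissible l≥3 x≥2 s bd) i = admissible
  (subst (3 ≤_) (sym (IncTwo-length i)) l≥3)
  (IncTwo-All id (λ x≥2 → ≤-trans x≥2 (n≤1+n _)) x≥2 i)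
  (sum-step (IncTwo-sum i) s)
  (subst (λ r → All (λ x → x + r ≤ suc n + 2) m') (sym (IncTwo-length i))
    (IncTwo-All (λ le → ≤-trans le (n≤1+n _)) s≤s bd i))

bound-shift : ∀ {y a r K} → y ≤ a → a + r ≤ K → y + suc r ≤ suc K
bound-shift {y} {a} {r} {K} y≤a a+r≤K =
  subst (_≤ suc K) (sym (+-suc y r)) (s≤s (≤-trans (+-monoˡ-≤ r y≤a) a+r≤K))

Split-admissible : ∀ {n m m'} → Admissible n m → Split m m' → Admissible (suc n) m'
Split-admissible {n} {m' = m'} (admissible l≥3 x≥2 s bd) sp = admissible
  (subst (3 ≤_) (sym (Split-length sp)) (≤-trans l≥3 (n≤1+n _)))
  (Split-All id (λ 1≤l l<a _ → s≤s 1≤l , s≤s (m<n⇒0<n∸m l<a)) x≥2 sp)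
  (sum-step (Split-sum sp) s)
  (subst (λ r → All (λ x → x + r ≤ suc n + 2) m') (sym (Split-length sp))
    (Split-All (bound-shift ≤-refl)
      (λ 1≤l l<a a+r≤ → bound-shift l<a a+r≤ , bound-shift (1≤l≤a⇒a∸l<a 1≤l (<⇒≤ l<a)) a+r≤)
      bd sp))

A-monomial : ℕ → ℕ → Mono
A-monomial n k = suc k ∷ suc (n ∸ k) ∷ n ∷ []

A-monomial-admissible : ∀ {n k} → 2 ≤ n → 1 ≤ k → k < n → Admissible (suc n) (A-monomial n k)
A-monomial-admissible {n} {k} n≥2 k≥1 k<n = admissible ≤-refl
  (s≤s k≥1 ∷ s≤s (m<n⇒0<n∸m k<n) ∷ n≥2 ∷ [])
  (sum≡ k (n ∸ k) (m+[n∸m]≡n (<⇒≤ k<n)))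
  (bound k<n ∷ bound (1≤l≤a⇒a∸l<a k≥1 (<⇒≤ k<n)) ∷ bound ≤-refl ∷ [])
  where
  sum≡ : ∀ k j {n} → k + j ≡ n → suc k + (suc j + (n + 0)) ≡ 2 * suc n
  sum≡ k j refl = identity k j
    where
    identity : ∀ k j → suc k + (suc j + ((k + j) + 0)) ≡ 2 * suc (k + j)
    identity = solve-∀
  bound : ∀ {x} → x ≤ n → x + 3 ≤ suc n + 2
  bound {x} x≤n = subst (x + 3 ≤_) (+-suc n 2) (+-monoˡ-≤ 3 x≤n)

SignCoherent : ℚ × Mono → Set
SignCoherent (q , m) = Signed (length m) q

GoodTerm : ℕ → ℚ × Mono → Set
GoodTerm n (q , m) = Admissible n m × SignCoherent (q , m)

A-good : ∀ {n} → 2 ≤ n → All (GoodTerm (suc n)) (A n)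
A-good {n} n≥2 = AllP.map⁺ (All.tabulate λ {k} k∈ →
  let 1≤k , k≤n∸1 = ∈-range⁻ {k} k∈
      k<n = 1≤l≤a∸1⇒l<a 1≤k k≤n∸1
  in A-monomial-admissible n≥2 1≤k k<n , ℚ.neg-pos {fromℕℚ (n C k)} (fromℕℚ-positive (nCk>0 (<⇒≤ k<n))))

L-good : ∀ {n P} → All (GoodTerm n) P → All (GoodTerm (suc n)) (L P)
L-good = AllP.concat⁺ ∘ AllP.map⁺ ∘ All.map λ { {q , m} (adm , sgn) →
  AllP.map⁺ (All.tabulate λ m'∈ →
    let i = ∈incTwo⇒IncTwo m m'∈ in
    IncTwo-admissible adm i , subst (λ r → Signed r q) (sym (IncTwo-length i)) sgn) }

H-good : ∀ {n P} → All (GoodTerm n) P → All (GoodTerm (suc n)) (H P)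
H-good = AllP.concat⁺ ∘ AllP.map⁺ ∘ All.map λ { {q , m} (adm , sgn) →
  AllP.map⁺ (All.map (λ { {q' , _} (q'<0 , sp) →
      Split-admissible adm sp ,
      subst (λ r → Signed r (q *ℚ q')) (sym (Split-length sp)) (Signed-*-neg (length m) sgn q'<0) })
    (splitAt1-negative-Split m)) }

R-good : ∀ k → All (GoodTerm (2 + k)) (R (2 + k))
R-good zero = []
R-good (suc k) = AllP.++⁺ (A-good (s≤s (s≤s z≤n))) (AllP.++⁺ (L-good (R-good k)) (H-good (R-good k)))

SortsTo : Mono → ℚ × Mono → Set
SortsTo α (_ , m) = sortDesc m ≡ α

length-sortDesc : ∀ m → length (sortDesc m) ≡ length m
length-sortDesc m = ↭-length (sortDesc-↭ m)

SortsTo⇒Signed : ∀ {α} t → SortsTo α t → SignCoherent t → Signed (length α) (proj₁ t)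
SortsTo⇒Signed (q , m) refl = subst (λ r → Signed r q) (sym (length-sortDesc m))

coeff≢0⇒SortsTo : ∀ P α → coeff P α ≢ 0ℚ → Any (SortsTo α) P
coeff≢0⇒SortsTo [] α c≢0 = ⊥-elim (c≢0 refl)
coeff≢0⇒SortsTo ((_ , m) ∷ P) α c≢0 with ≡-dec _≟_ (sortDesc m) α
... | yes m↦α = here m↦α
... | no _ = there (coeff≢0⇒SortsTo P α c≢0)

coeff-weaklySigned : ∀ P α → All SignCoherent P → WeaklySigned (length α) (coeff P α)
coeff-weaklySigned [] α [] = WeaklySigned-0 (length α)
coeff-weaklySigned (t@(_ , m) ∷ P) α (sgn ∷ sgns) with ≡-dec _≟_ (sortDesc m) α
... | yes m↦α = WeaklySigned-+ (length α)
  (Signed⇒WeaklySigned (length α) (SortsTo⇒Signed t m↦α sgn)) (coeff-weaklySigned P α sgns)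
... | no _ = coeff-weaklySigned P α sgns

coeff-signed : ∀ P α → All SignCoherent P → Any (SortsTo α) P → Signed (length α) (coeff P α)
coeff-signed (t@(_ , m) ∷ P) α (sgn ∷ sgns) occ with ≡-dec _≟_ (sortDesc m) α | occ
... | yes m↦α | _ = Signed-+ (length α) (SortsTo⇒Signed t m↦α sgn) (coeff-weaklySigned P α sgns)
... | no m↛α | here m↦α = ⊥-elim (m↛α m↦α)
... | no _ | there occ' = coeff-signed P α sgns occ'

Occurs : Mono → Poly → Set
Occurs m = Any ((m ≡_) ∘ proj₂)

A-occurs : ∀ {n k} → 1 ≤ k → k ≤ n ∸ 1 → Occurs (A-monomial n k) (A n)
A-occurs {n} 1≤k k≤n∸1 = AnyP.map⁺ (Any.map (cong (A-monomial n)) (∈-range⁺ 1≤k k≤n∸1))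

L-occurs : ∀ P {m m'} → Occurs m P → IncTwo m m' → Occurs m' (L P)
L-occurs (_ ∷ P) (here refl) i = AnyP.++⁺ˡ (AnyP.map⁺ (IncTwo⇒∈incTwo i))
L-occurs (_ ∷ P) (there occ) i = AnyP.++⁺ʳ _ (L-occurs P occ i)

H-occurs : ∀ P {m m'} → Occurs m P → Split m m' → Occurs m' (H P)
H-occurs (_ ∷ P) (here refl) s = AnyP.++⁺ˡ (AnyP.map⁺ (Split⇒∈splitAt1 s))
H-occurs (_ ∷ P) (there occ) s = AnyP.++⁺ʳ _ (H-occurs P occ s)

Realised : ℕ → Mono → Set
Realised n β = ∃[ m ] Occurs m (R n) × m ↭ β

Realised-resp-↭ : ∀ {n β β'} → β ↭ β' → Realised n β → Realised n β'
Realised-resp-↭ β↭β' (m , occ , m↭β) = m , occ , ↭-trans m↭β β↭β'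

IncTwo-realised : ∀ k {δ γ} → Realised (2 + k) δ → IncTwo δ γ → Realised (3 + k) γ
IncTwo-realised k (m , occ , m↭δ) i with lift-IncTwo m↭δ i
... | m' , j , m'↭γ = m' , AnyP.++⁺ʳ (A (2 + k)) (AnyP.++⁺ˡ (L-occurs (R (2 + k)) occ j)) , m'↭γ

Split-realised : ∀ k {δ γ} → Realised (2 + k) δ → Split δ γ → Realised (3 + k) γ
Split-realised k (m , occ , m↭δ) s with lift-Split m↭δ s
... | m' , t , m'↭γ = m' , AnyP.++⁺ʳ (A (2 + k)) (AnyP.++⁺ʳ (L (R (2 + k))) (H-occurs (R (2 + k)) occ t)) , m'↭γ

AllRealised : ℕ → Set
AllRealised n = ∀ δ → Admissible n δ → Realised n δ

bound⇒≤∸1 : ∀ {x r n} → 3 ≤ r → x + r ≤ n + 2 → x ≤ n ∸ 1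
bound⇒≤∸1 {x} {r} {zero} r≥3 bd with ≤-trans r≥3 (≤-trans (m≤n+m r x) bd)
... | s≤s (s≤s ())
bound⇒≤∸1 {x} {r} {suc n} r≥3 bd =
  +-cancelʳ-≤ 3 x n (subst (x + 3 ≤_) (sym (+-suc n 2)) (≤-trans (+-monoʳ-≤ x r≥3) bd))

<⇒bound : ∀ {x n} → x < n → x + 3 ≤ n + 2
<⇒bound {x} {n} x<n = subst (_≤ n + 2) (sym (+-suc x 2)) (+-monoˡ-≤ 2 x<n)

bound-unshift : ∀ {w r K} → w + suc r ≤ suc K → w + r ≤ K
bound-unshift {w} {r} {K} bd = s≤s⁻¹ (subst (_≤ suc K) (+-suc w r) bd)

triple-middle≥3 : ∀ {c b a n} → 2 ≤ n → c ≤ b → a < n → c + (b + (a + 0)) ≡ 2 * suc n → 3 ≤ b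
triple-middle≥3 {c} {b} {a} {n} n≥2 c≤b a<n s with 3 ≤? b
... | yes b≥3 = b≥3
... | no b≱3 = ⊥-elim (1+n≰n (≤-trans n≥2 n≤1))
  where
  open ≤-Reasoning
  b≤2 : b ≤ 2
  b≤2 = s≤s⁻¹ (≰⇒> b≱3)
  identity₁ : ∀ n → n + (n + 3) ≡ 2 * suc n + 1
  identity₁ = solve-∀
  identity₂ : ∀ c b a → c + (b + (a + 0)) + 1 ≡ c + (b + suc a)
  identity₂ = solve-∀
  identity₃ : ∀ n → 2 + (2 + n) ≡ n + (1 + 3)
  identity₃ = solve-∀
  n≤1 : n ≤ 1
  n≤1 = +-cancelʳ-≤ 3 n 1 (+-cancelˡ-≤ n _ _ (begin
    n + (n + 3)            ≡⟨ identity₁ n ⟩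
    2 * suc n + 1          ≡⟨ cong (_+ 1) (sym s) ⟩
    c + (b + (a + 0)) + 1  ≡⟨ identity₂ c b a ⟩
    c + (b + suc a)        ≤⟨ +-mono-≤ (≤-trans c≤b b≤2) (+-mono-≤ b≤2 a<n) ⟩
    2 + (2 + n)            ≡⟨ identity₃ n ⟩
    n + (1 + 3)            ∎))

A-first-factor : ∀ {c b' n} → b' ≤ n → c + (suc b' + (n + 0)) ≡ 2 * suc n → c ≡ suc (n ∸ b')
A-first-factor {c} {b'} {n} b'≤n s =
  +-cancelʳ-≡ (suc b' + (n + 0)) c (suc (n ∸ b')) (≡.trans s (split-sum b' (n ∸ b') (m+[n∸m]≡n b'≤n)))
  where
  identity : ∀ b' d → 2 * suc (b' + d) ≡ suc d + (suc b' + ((b' + d) + 0))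
  identity = solve-∀
  split-sum : ∀ b' d {n} → b' + d ≡ n → 2 * suc n ≡ suc d + (suc b' + (n + 0))
  split-sum b' d refl = identity b' d

triple-realised : ∀ k {c b a} → c ≤ b → b ≤ a → Admissible (3 + k) (c ∷ b ∷ a ∷ [])
                → AllRealised (2 + k) → Realised (3 + k) (c ∷ b ∷ a ∷ [])
triple-realised k {b = zero} _ _ (admissible _ (_ ∷ () ∷ _) _ _) _
triple-realised k {b = suc _} {zero} _ () _ _
triple-realised k {c} {suc b'} {suc a'} c≤b b≤a
  (admissible _ (c≥2 ∷ b≥2 ∷ _ ∷ []) s (_ ∷ _ ∷ a-bd ∷ [])) ih
  with m≤n⇒m<n∨m≡n (bound⇒≤∸1 {suc a'} {n = 3 + k} ≤-refl a-bd)
... | inj₂ refl with A-first-factor (<⇒≤ b≤a) s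
...   | refl = A-monomial (2 + k) b' , AnyP.++⁺ˡ (A-occurs (s≤s⁻¹ b≥2) (s≤s⁻¹ b≤a)) , swap _ _ refl
triple-realised k {c} {suc b'} {suc a'} c≤b b≤a (admissible _ (c≥2 ∷ b≥2 ∷ _ ∷ []) s _) ih
    | inj₁ a<n = IncTwo-realised k (ih δ δ-admissible) lower
  where
  δ = c ∷ b' ∷ a' ∷ []
  lower : IncTwo δ (c ∷ suc b' ∷ suc a' ∷ [])
  lower = inc₂-there (inc₂-here inc₁-here)
  b'≥2 : 2 ≤ b'
  b'≥2 = s≤s⁻¹ (triple-middle≥3 (s≤s (s≤s z≤n)) c≤b a<n s)
  δ-admissible : Admissible (2 + k) δ
  δ-admissible = admissible ≤-refl
    (c≥2 ∷ b'≥2 ∷ ≤-trans b'≥2 (s≤s⁻¹ b≤a) ∷ [])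
    (sum-unstep {n = 2 + k} (IncTwo-sum lower) s)
    (<⇒bound (≤-<-trans (≤-trans c≤b b≤a) a<n)
      ∷ <⇒bound (≤-<-trans (≤-trans (n≤1+n b') b≤a) a<n)
      ∷ <⇒bound (≤-<-trans (n≤1+n a') a<n) ∷ [])

m≤m+n∸1 : ∀ m {n} → 1 ≤ n → m ≤ m + n ∸ 1
m≤m+n∸1 m {suc n} _ = subst (λ z → m ≤ z ∸ 1) (sym (+-suc m n)) (m≤m+n m n)

-- Merging the two smallest factors x' + 1 ≤ y' + 1 into x' + y' keeps the bound because the
-- remaining factors, each at least y' + 1 and at least 2, weigh at least 2(y' + 1) + 2t.
merged-bound : ∀ {x' y' t S n} → x' ≤ y' → suc y' + (suc y' + 2 * t) ≤ S
             → suc x' + (suc y' + S) ≡ 2 * suc n → (x' + y') + (3 + t) ≤ n + 2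
merged-bound {x'} {y'} {t} {S} {n} x'≤y' S≥ s = *-cancelˡ-≤ 2 (begin
  2 * ((x' + y') + (3 + t))                    ≡⟨ identity₁ x' y' t ⟩
  (x' + y') + ((suc x' + suc y') + 2 * t) + 4  ≤⟨ +-monoˡ-≤ 4 (+-monoʳ-≤ (x' + y') others) ⟩
  (x' + y') + S + 4                            ≡⟨ identity₂ x' y' S ⟩
  suc x' + (suc y' + S) + 2                    ≡⟨ cong (_+ 2) s ⟩
  2 * suc n + 2                                ≡⟨ identity₃ n ⟩
  2 * (n + 2)                                  ∎)
  where
  open ≤-Reasoning
  identity₁ : ∀ x' y' t → 2 * ((x' + y') + (3 + t)) ≡ (x' + y') + ((suc x' + suc y') + 2 * t) + 4
  identity₁ = solve-∀
  identity₂ : ∀ x' y' S → (x' + y') + S + 4 ≡ suc x' + (suc y' + S) + 2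
  identity₂ = solve-∀
  identity₃ : ∀ n → 2 * suc n + 2 ≡ 2 * (n + 2)
  identity₃ = solve-∀
  others : (suc x' + suc y') + 2 * t ≤ S
  others = ≤-trans (+-monoˡ-≤ (2 * t) (+-monoˡ-≤ (suc y') (s≤s x'≤y')))
    (subst (_≤ S) (sym (+-assoc (suc y') (suc y') (2 * t))) S≥)

merge-realised : ∀ k {x' y' w₁ w₂ ws} → let γ = suc x' ∷ suc y' ∷ w₁ ∷ w₂ ∷ ws in
                 Sorted ≤-totalOrder γ → Admissible (3 + k) γ → AllRealised (2 + k) → Realised (3 + k) γ
merge-realised k {x'} {y'} {w₁} {w₂} {ws} (x≤y ∷ y≤w₁ ∷ w₁≤w₂ ∷ _)
  (admissible _ (x≥2 ∷ y≥2 ∷ w₁≥2 ∷ w₂≥2 ∷ ws≥2) s (_ ∷ _ ∷ w₁-bd ∷ w₂-bd ∷ ws-bd)) ih =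
  Split-realised k (ih δ δ-admissible) split
  where
  δ = x' + y' ∷ w₁ ∷ w₂ ∷ ws
  split : Split δ (suc x' ∷ suc y' ∷ w₁ ∷ w₂ ∷ ws)
  split = subst (λ u → Split δ (suc x' ∷ suc u ∷ w₁ ∷ w₂ ∷ ws)) (m+n∸m≡n x' y')
    (split-here (s≤s⁻¹ x≥2) (m≤m+n∸1 x' (s≤s⁻¹ y≥2)))
  δ-admissible : Admissible (2 + k) δ
  δ-admissible = admissible (s≤s (s≤s (s≤s z≤n)))
    (+-mono-≤ (s≤s⁻¹ x≥2) (s≤s⁻¹ y≥2) ∷ w₁≥2 ∷ w₂≥2 ∷ ws≥2)
    (sum-unstep {n = 2 + k} (Split-sum split) s)
    (merged-bound {n = 2 + k} (s≤s⁻¹ x≤y)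
        (+-mono-≤ y≤w₁ (+-mono-≤ (≤-trans y≤w₁ w₁≤w₂) (2*length≤sum ws ws≥2))) s
      ∷ bound-unshift w₁-bd ∷ bound-unshift w₂-bd ∷ All.map bound-unshift ws-bd)

increasing-realised : ∀ k {γ} → Sorted ≤-totalOrder γ → Admissible (3 + k) γ → AllRealised (2 + k)
                    → Realised (3 + k) γ
increasing-realised k {[]} _ (admissible () _ _ _) _
increasing-realised k {_ ∷ []} _ (admissible (s≤s ()) _ _ _) _
increasing-realised k {_ ∷ _ ∷ []} _ (admissible (s≤s (s≤s ())) _ _ _) _
increasing-realised k {_ ∷ _ ∷ _ ∷ []} (c≤b ∷ b≤a ∷ [-]) = triple-realised k c≤b b≤a
increasing-realised k {zero ∷ _ ∷ _ ∷ _ ∷ _} _ (admissible _ (() ∷ _) _ _) _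
increasing-realised k {suc _ ∷ zero ∷ _ ∷ _ ∷ _} _ (admissible _ (_ ∷ () ∷ _) _ _) _
increasing-realised k {suc _ ∷ suc _ ∷ _ ∷ _ ∷ _} = merge-realised k

admissible⇒realised : ∀ k → AllRealised (2 + k)
admissible⇒realised zero β adm = ⊥-elim (¬Admissible-2 adm)
admissible⇒realised (suc k) β adm = Realised-resp-↭ (sort-↭ β)
  (increasing-realised k (sort-increasing β) (Admissible-resp-↭ (↭-sym (sort-↭ β)) adm)
    (admissible⇒realised k))

SortsTo⇒admissible : ∀ {n α P} → All (GoodTerm n) P → Any (SortsTo α) P → Admissible n α
SortsTo⇒admissible ((adm , _) ∷ _) (here refl) = Admissible-resp-↭ (↭-sym (sortDesc-↭ _)) adm
SortsTo⇒admissible (_ ∷ goods) (there m↦α) = SortsTo⇒admissible goods m↦α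

c≢0⇒admissible : ∀ k α → c (2 + k) α ≢ 0ℚ → Admissible (2 + k) α
c≢0⇒admissible k α c≢0 = SortsTo⇒admissible (R-good k) (coeff≢0⇒SortsTo (R (2 + k)) α c≢0)

admissible⇒c≢0 : ∀ k {α} → Nonincreasing α → Admissible (2 + k) α → c (2 + k) α ≢ 0ℚ
admissible⇒c≢0 k {α} α↘ adm with admissible⇒realised k α adm
... | m , occ , m↭α = Signed⇒≢0 (length α)
  (coeff-signed (R (2 + k)) α (All.map proj₂ (R-good k))
    (Any.map (λ m≡ → subst (SortsTo α ∘ (0ℚ ,_)) m≡ m↦α) occ))
  where
  m↦α : sortDesc m ≡ α
  m↦α = nonincreasing-↭⇒≡ (sortDesc-nonincreasing m) α↘ (↭-trans (sortDesc-↭ m) m↭α)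

DomCond⇔head-bound : ∀ {d r S n} → d + S ≡ 2 * n → d + 2 * r ≤ S + 4 ⇔ d + r ≤ n + 2
DomCond⇔head-bound {d} {r} {S} {n} s = mk⇔
  (λ dom → *-cancelˡ-≤ 2 (begin
    2 * (d + r)        ≡⟨ identity d r ⟩
    d + (d + 2 * r)    ≤⟨ +-monoʳ-≤ d dom ⟩
    d + (S + 4)        ≡⟨ total ⟩
    2 * (n + 2)        ∎))
  (λ bd → +-cancelˡ-≤ d _ _ (begin
    d + (d + 2 * r)    ≡⟨ identity d r ⟨
    2 * (d + r)        ≤⟨ *-monoʳ-≤ 2 bd ⟩
    2 * (n + 2)        ≡⟨ total ⟨
    d + (S + 4)        ∎))
  where
  open ≤-Reasoning
  identity : ∀ d r → 2 * (d + r) ≡ d + (d + 2 * r)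
  identity = solve-∀
  doubling : ∀ n → 2 * n + 4 ≡ 2 * (n + 2)
  doubling = solve-∀
  total : d + (S + 4) ≡ 2 * (n + 2)
  total = ≡.trans (sym (+-assoc d S 4)) (≡.trans (cong (_+ 4) s) (doubling n))

Admissible⇒DomCond : ∀ {n α} → Admissible n α → DomCond α
Admissible⇒DomCond {α = d ∷ _} (admissible _ _ s (d-bd ∷ _)) = Equivalence.from (DomCond⇔head-bound s) d-bd

DNSG⇒Admissible : ∀ {n α} → DNSG n α → Admissible n α
DNSG⇒Admissible {n} {d ∷ ds} (l≥3 , d∷ds↘ , x≥2 , s , dom) = admissible l≥3 x≥2 s (d-bd ∷ ds-bd d∷ds↘)
  where
  d-bd = Equivalence.to (DomCond⇔head-bound s) dom
  ds-bd : Nonincreasing (d ∷ ds) → All (λ x → x + length (d ∷ ds) ≤ n + 2) ds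
  ds-bd [-] = []
  ds-bd (d≥e ∷ e∷es↘) =
    All.map (λ x≤d → ≤-trans (+-monoˡ-≤ _ x≤d) d-bd) (Linked⇒All (flip ≤-trans) d≥e e∷es↘)

proposition2p8 : (n : ℕ) → 3 ≤ n → (α : List ℕ) → I* n α ⇔ DNSG n α
proposition2p8 1 (s≤s ()) α
proposition2p8 (suc (suc k)) _ α = mk⇔ forward backward
  where
  forward : I* (2 + k) α → DNSG (2 + k) α
  forward ((l≥3 , α↘ , bounds , s) , c≢0) =
    l≥3 , α↘ , All.map proj₁ bounds , s , Admissible⇒DomCond (c≢0⇒admissible k α c≢0)
  backward : DNSG (2 + k) α → I* (2 + k) α
  backward dnsg@(l≥3 , α↘ , x≥2 , s , _) =
    (l≥3 , α↘ , All.zip (x≥2 , All.map (bound⇒≤∸1 {n = 2 + k} l≥3) (Admissible.bounded adm)) , s) ,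
    admissible⇒c≢0 k α↘ adm
    where adm = DNSG⇒Admissible dnsg
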